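{- Let $G$ be a graph, $L$ a list assignment on the vertices of the total graph $\mathcal{T}(G)$, $\gamma$ a partial $L$-coloring of $\mathcal{T}(G)$, and $S$ a clique of $\mathcal{T}(G)$ all of whose elements are colored by $\gamma$. For every vertex $x$ of the color shifting graph $H_{S,\gamma}$, its in-degree satisfies $d^-(x)=|\hat{x}|-1$ if $x\in S$, and $d^-(x)=|V(H_{S,\gamma})|-1$ otherwise.
   Context: The total graph $\mathcal{T}(G)$ has vertex set $V(G)\cup E(G)$, two elements being adjacent if they are adjacent vertices of $G$, or incident vertex and edge, or two edges sharing an endpoint. A list assignment $L$ gives each vertex $x$ of $\mathcal{T}(G)$ a set $L(x)$ of colors; a partial $L$-coloring is a map $\gamma$ defined on a subset of $V(\mathcal{T}(G))$ with $\gamma(x)\in L(x)$ and $\gamma(x)\neq\gamma(y)$ whenever $x,y$ are adjacent and both colored. For $x\in S$, let $\hat{x}$ be the set of colors of $L(x)$ not equal to $\gamma(y)$ for any colored neighbor $y\notin S$ of $x$ in $\mathcal{T}(G)$. The color shifting graph $H_{S,\gamma}$ is the loopless digraph whose vertices are the elements of $S$ together with a new vertex $s_\alpha$ for each color $\alpha\in\bigcup_{x\in S}\hat{x}$, with arcs: $x\to y$ for distinct $x,y\in S$ whenever $\gamma(x)\in\hat{y}$; $s_\alpha\to x$ for $x\in S$ whenever $\alpha\in\hat{x}$ and $\alpha\notin\gamma(S)$; $x\to s_\alpha$ for every $x\in S$ and every $\alpha$; and $s_\alpha\to s_\beta$ for all $\alpha\neq\beta$. -}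

module Defs where

open import Data.Nat using (ℕ; zero; suc)
open import Data.Bool using (Bool; true; false; _∧_; _∨_; not; T)
open import Data.Fin using (Fin)
open import Data.Fin.Subset using (Subset; _∈_)
open import Data.Vec using (tabulate; lookup)
open import Data.Maybe using (Maybe; just; nothing)
open import Data.Product using (_×_; _,_; proj₁; proj₂; ∃)
open import Data.Sum using (_⊎_; inj₁; inj₂)
open import Data.List using (List; allFin; map; _++_; filter; length)
open import Data.Bool.ListAction using (any)
open import Relation.Nullary using (¬_)
open import Relation.Nullary.Decidable using (⌊_⌋)
open import Relation.Binary.PropositionalEquality using (_≡_; _≢_)
import Data.Fin as F

record Graph : Set where
  field
    nV nE   : ℕ
    ends    : Fin nE → Fin nV × Fin nV
    loopless : ∀ e → proj₁ (ends e) ≢ proj₂ (ends e)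
    simple  : ∀ e f →
              (proj₁ (ends e) ≡ proj₁ (ends f) × proj₂ (ends e) ≡ proj₂ (ends f)) ⊎
              (proj₁ (ends e) ≡ proj₂ (ends f) × proj₂ (ends e) ≡ proj₁ (ends f)) →
              e ≡ f

module _ (G : Graph) where
  open Graph G

  -- Elements of the total graph T(G): vertices and edges of G.
  Elt : Set
  Elt = Fin nV ⊎ Fin nE

  eltList : List Elt
  eltList = map inj₁ (allFin nV) ++ map inj₂ (allFin nE)

  anyElt : (Elt → Bool) → Bool
  anyElt p = any p eltList

  countElt : (Elt → Bool) → ℕ
  countElt p = length (filter (λ x → T? (p x)) eltList)
    where
    open import Data.Bool using (T?)

  eqV : Fin nV → Fin nV → Bool
  eqV u v = ⌊ u F.≟ v ⌋

  eqE : Fin nE → Fin nE → Bool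
  eqE e f = ⌊ e F.≟ f ⌋

  incB : Fin nV → Fin nE → Bool
  incB u e = eqV u (proj₁ (ends e)) ∨ eqV u (proj₂ (ends e))

  adjGB : Fin nV → Fin nV → Bool
  adjGB u v = any (λ e → (eqV u (proj₁ (ends e)) ∧ eqV v (proj₂ (ends e)))
                       ∨ (eqV v (proj₁ (ends e)) ∧ eqV u (proj₂ (ends e))))
                  (allFin nE)

  shareB : Fin nE → Fin nE → Bool
  shareB e f = not (eqE e f) ∧ (incB (proj₁ (ends e)) f ∨ incB (proj₂ (ends e)) f)

  tadjB : Elt → Elt → Bool
  tadjB (inj₁ u) (inj₁ v) = adjGB u v
  tadjB (inj₁ u) (inj₂ e) = incB u e
  tadjB (inj₂ e) (inj₁ u) = incB u e
  tadjB (inj₂ e) (inj₂ f) = shareB e f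

  TAdj : Elt → Elt → Set
  TAdj x y = T (tadjB x y)

  eqElt : Elt → Elt → Bool
  eqElt (inj₁ u) (inj₁ v) = eqV u v
  eqElt (inj₂ e) (inj₂ f) = eqE e f
  eqElt _ _ = false

  record IsPartialColoring {c : ℕ} (L : Elt → Subset c) (γ : Elt → Maybe (Fin c)) : Set where
    field
      inList : ∀ x α → γ x ≡ just α → α ∈ L x
      proper : ∀ x y α β → TAdj x y → γ x ≡ just α → γ y ≡ just β → α ≢ β

  IsClique : (Elt → Bool) → Set
  IsClique S = ∀ x y → T (S x) → T (S y) → x ≢ y → TAdj x y

  AllColored : {c : ℕ} → (Elt → Maybe (Fin c)) → (Elt → Bool) → Set
  AllColored γ S = ∀ x → T (S x) → ∃ λ α → γ x ≡ just α

  isCol : {c : ℕ} → Maybe (Fin c) → Fin c → Bool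
  isCol nothing α = false
  isCol (just β) α = ⌊ β F.≟ α ⌋

  module ColorShift {c : ℕ} (L : Elt → Subset c) (γ : Elt → Maybe (Fin c))
                    (S : Elt → Bool) where

    hat : Elt → Subset c
    hat x = tabulate λ α → lookup (L x) α ∧
              not (anyElt (λ y → not (S y) ∧ tadjB x y ∧ isCol (γ y) α))

    U : Fin c → Bool
    U α = anyElt (λ x → S x ∧ lookup (hat x) α)

    γS : Fin c → Bool
    γS α = anyElt (λ y → S y ∧ isCol (γ y) α)

    -- ambient type of vertices of H: inj₁ x for x ∈ S, inj₂ α for s_α
    HV : Set
    HV = Elt ⊎ Fin c

    inH : HV → Bool
    inH (inj₁ x) = S x
    inH (inj₂ α) = U α

    colIn : Maybe (Fin c) → Subset c → Bool
    colIn nothing  _ = false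
    colIn (just α) A = lookup A α

    arc : HV → HV → Bool
    arc (inj₁ x) (inj₁ y) = S x ∧ S y ∧ not (eqElt x y) ∧ colIn (γ x) (hat y)
    arc (inj₂ α) (inj₁ y) = U α ∧ S y ∧ lookup (hat y) α ∧ not (γS α)
    arc (inj₁ x) (inj₂ α) = S x ∧ U α
    arc (inj₂ α) (inj₂ β) = U α ∧ U β ∧ not ⌊ α F.≟ β ⌋

    countHV : (HV → Bool) → ℕ
    countHV p = length (filter (λ v → T? (p v))
                  (map inj₁ eltList ++ map inj₂ (allFin c)))
      where
      open import Data.Bool using (T?)

    sizeH : ℕ
    sizeH = countHV inH

    inDeg : HV → ℕ
    inDeg v = countHV (λ u → inH u ∧ arc u v)

-- The vertex s_α receives an arc from every other vertex of H. An element x ∈ S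
-- receives arcs from the y ∈ S ∖ {x} with γ(y) ∈ x̂ and from the s_β with
-- β ∈ x̂ ∖ γ(S). As S is a clique and γ is proper, γ is injective on S, so the
-- first kind are in bijection with (x̂ ∩ γ(S)) ∖ {γ(x)}; and γ(x) ∈ x̂ because
-- no colored neighbor of x carries its color. Together they number |x̂| − 1.
module Submission where

open import Defs
open import Data.Nat using (ℕ; suc; _+_)
open import Data.Nat.Properties using (+-suc)
open import Data.Bool using (Bool; T; true; false; _∧_; _∨_; not)
open import Data.Bool.Properties using (∧-zeroʳ; ∧-identityʳ; ∧-comm; T-≡)
open import Data.Bool.ListAction using (any)
open import Data.Fin using (Fin)
import Data.Fin as F
open import Data.Fin.Subset using (Subset; ∣_∣)
open import Data.Maybe using (Maybe; just; nothing)
open import Data.Product using (_×_; _,_; proj₂)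
open import Data.Sum using (inj₁; inj₂)
open import Data.Sum.Properties using (≡-dec; inj₁-injective; inj₂-injective)
open import Data.List using (List; []; _∷_; _++_; map; length; filterᵇ; allFin)
import Data.List as List
open import Data.List.Properties using (filter-++; length-++; map-tabulate)
open import Data.List.Relation.Unary.All using (All; []; _∷_)
import Data.List.Relation.Unary.All as All
open import Data.List.Relation.Unary.Any using (here; there)
open import Data.List.Relation.Unary.AllPairs using (_∷_)
open import Data.List.Membership.Propositional using (_∈_)
open import Data.List.Membership.Propositional.Properties
  using (∈-allFin; ∈-map⁺; ∈-map⁻; ∈-++⁺ˡ; ∈-++⁺ʳ)
open import Data.List.Relation.Unary.Unique.Propositional using (Unique)
import Data.List.Relation.Unary.Unique.Propositional.Properties as Unique
import Data.Vec as Vec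
open import Data.Vec.Properties using (lookup∘tabulate; []=⇒lookup)
open import Function using (_∘_; Equivalence)
open Equivalence using (to; from)
open import Relation.Binary.Definitions using (DecidableEquality)
open import Relation.Binary.PropositionalEquality
open import Relation.Nullary using (¬_; yes; no)
open import Relation.Nullary.Decidable using (⌊_⌋)
open import Relation.Nullary.Negation using (contradiction)

module _ {A : Set} where

  count : (A → Bool) → List A → ℕ
  count p xs = length (filterᵇ p xs)

  count-++ : ∀ (p : A → Bool) xs ys → count p (xs ++ ys) ≡ count p xs + count p ys
  count-++ p xs ys = trans (cong length (filter-++ _ xs ys)) (length-++ (filterᵇ p xs))

  count-cong : ∀ {p q} → (∀ x → p x ≡ q x) → ∀ xs → count p xs ≡ count q xs
  count-cong p≗q [] = refl
  count-cong {q = q} p≗q (x ∷ xs) rewrite p≗q x with q x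
  ... | true  = cong suc (count-cong p≗q xs)
  ... | false = count-cong p≗q xs

  count-none : ∀ {p} → (∀ x → p x ≡ false) → ∀ xs → count p xs ≡ 0
  count-none p≗false []       = refl
  count-none p≗false (x ∷ xs) rewrite p≗false x = count-none p≗false xs

  count-partition : ∀ (p q : A → Bool) xs →
    count p xs ≡ count (λ x → p x ∧ q x) xs + count (λ x → p x ∧ not (q x)) xs
  count-partition p q [] = refl
  count-partition p q (x ∷ xs) with p x | q x
  ... | true  | true  = cong suc (count-partition p q xs)
  ... | true  | false = trans (cong suc (count-partition p q xs)) (sym (+-suc _ _))
  ... | false | _     = count-partition p q xs

  any-≡true : ∀ (p : A → Bool) {x xs} → x ∈ xs → p x ≡ true → any p xs ≡ true
  any-≡true p (here refl) px rewrite px = refl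
  any-≡true p {xs = y ∷ _} (there x∈xs) px with p y
  ... | true  = refl
  ... | false = any-≡true p x∈xs px

  any-≡false : ∀ (p : A → Bool) {xs} → All (λ x → p x ≡ false) xs → any p xs ≡ false
  any-≡false p []           = refl
  any-≡false p (px ∷ pxs) rewrite px = any-≡false p pxs

count-map : ∀ {A B : Set} (p : B → Bool) (f : A → B) xs → count p (map f xs) ≡ count (p ∘ f) xs
count-map p f [] = refl
count-map p f (x ∷ xs) with p (f x)
... | true  = cong suc (count-map p f xs)
... | false = count-map p f xs

count-tabulate : ∀ {A : Set} {n} (p : A → Bool) (g : Fin n → A) →
                 count p (List.tabulate g) ≡ count (p ∘ g) (allFin n)
count-tabulate p g =
  trans (cong (count p) (sym (map-tabulate (λ i → i) g))) (count-map p g (allFin _))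

∣p∣≡count-allFin : ∀ {n} (p : Subset n) → ∣ p ∣ ≡ count (Vec.lookup p) (allFin n)
∣p∣≡count-allFin Vec.[] = refl
∣p∣≡count-allFin (true  Vec.∷ p) =
  cong suc (trans (∣p∣≡count-allFin p) (sym (count-tabulate (Vec.lookup (true Vec.∷ p)) F.suc)))
∣p∣≡count-allFin (false Vec.∷ p) =
  trans (∣p∣≡count-allFin p) (sym (count-tabulate (Vec.lookup (false Vec.∷ p)) F.suc))

module _ {A : Set} (_≟_ : DecidableEquality A) where

  count-∉ : ∀ (p : A → Bool) {x xs} → All (x ≢_) xs →
            count p xs ≡ count (λ y → p y ∧ not ⌊ y ≟ x ⌋) xs
  count-∉ p [] = refl
  count-∉ p {x} {y ∷ ys} (x≢y ∷ x∉ys) with y ≟ x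
  ... | yes y≡x = contradiction (sym y≡x) x≢y
  ... | no _ with p y
  ...   | true  = cong suc (count-∉ p x∉ys)
  ...   | false = count-∉ p x∉ys

  count-∈ : ∀ (p : A → Bool) {x xs} → Unique xs → x ∈ xs → p x ≡ true →
            count p xs ≡ suc (count (λ y → p y ∧ not ⌊ y ≟ x ⌋) xs)
  count-∈ p {x} (x∉ys ∷ _) (here refl) px with x ≟ x
  ... | no x≢x = contradiction refl x≢x
  ... | yes _ rewrite px = cong suc (count-∉ p x∉ys)
  count-∈ p {x} {y ∷ ys} (y∉ys ∷ ys-unique) (there x∈ys) px with y ≟ x
  ... | yes refl = contradiction refl (All.lookup y∉ys x∈ys)
  ... | no _ with p y
  ...   | true  = cong suc (count-∈ p ys-unique x∈ys px)
  ...   | false = count-∈ p ys-unique x∈ys px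

module _ (G : Graph) where

  _≟ᴱ_ : DecidableEquality (Elt G)
  _≟ᴱ_ = ≡-dec F._≟_ F._≟_

  eqElt≡⌊≟ᴱ⌋ : ∀ x y → eqElt G x y ≡ ⌊ x ≟ᴱ y ⌋
  eqElt≡⌊≟ᴱ⌋ (inj₁ u) (inj₁ v) with u F.≟ v
  ... | yes _ = refl
  ... | no  _ = refl
  eqElt≡⌊≟ᴱ⌋ (inj₁ _) (inj₂ _) = refl
  eqElt≡⌊≟ᴱ⌋ (inj₂ _) (inj₁ _) = refl
  eqElt≡⌊≟ᴱ⌋ (inj₂ e) (inj₂ f) with e F.≟ f
  ... | yes _ = refl
  ... | no  _ = refl

  eltList-unique : Unique (eltList G)
  eltList-unique = Unique.++⁺ (Unique.map⁺ inj₁-injective (Unique.allFin⁺ _))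
                              (Unique.map⁺ inj₂-injective (Unique.allFin⁺ _))
                              disjoint
    where
    disjoint : ∀ {x} → ¬ (x ∈ map inj₁ (allFin _) × x ∈ map inj₂ (allFin _))
    disjoint (x∈₁ , x∈₂) with ∈-map⁻ inj₁ x∈₁ | ∈-map⁻ inj₂ x∈₂
    ... | _ , _ , refl | _ , _ , ()

  ∈-eltList : ∀ x → x ∈ eltList G
  ∈-eltList (inj₁ u) = ∈-++⁺ˡ (∈-map⁺ inj₁ (∈-allFin u))
  ∈-eltList (inj₂ e) = ∈-++⁺ʳ (map inj₁ (allFin _)) (∈-map⁺ inj₂ (∈-allFin e))

  module _ {c : ℕ} (L : Elt G → Subset c) (γ : Elt G → Maybe (Fin c)) (S : Elt G → Bool) where
    open ColorShift G L γ S

    InjectiveOnS : Set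
    InjectiveOnS = ∀ {y z α} → S y ≡ true → S z ≡ true → γ y ≡ just α → γ z ≡ just α → y ≡ z

    clique⇒injectiveOnS : IsPartialColoring G L γ → IsClique G S → InjectiveOnS
    clique⇒injectiveOnS pc clique {y} {z} {α} Sy Sz γy γz with y ≟ᴱ z
    ... | yes y≡z = y≡z
    ... | no  y≢z = contradiction refl
          (IsPartialColoring.proper pc y z α α (clique y z (T-≡ .from Sy) (T-≡ .from Sz) y≢z) γy γz)

    γ∈hat : IsPartialColoring G L γ → ∀ {x α} → γ x ≡ just α → Vec.lookup (hat x) α ≡ true
    γ∈hat pc {x} {α} γx = begin
      Vec.lookup (hat x) α
        ≡⟨ lookup∘tabulate _ α ⟩
      Vec.lookup (L x) α ∧ not (anyElt G _)
        ≡⟨ cong₂ (λ a b → a ∧ not b) ([]=⇒lookup (inList x α γx))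
                 (any-≡false _ (All.universal noClash (eltList G))) ⟩
      true
        ∎
      where
      open ≡-Reasoning
      open IsPartialColoring pc
      noClash : ∀ z → not (S z) ∧ tadjB G x z ∧ isCol G (γ z) α ≡ false
      noClash z with S z | tadjB G x z in adj | γ z in γz
      ... | true  | _     | _      = refl
      ... | false | false | _      = refl
      ... | false | true  | nothing = refl
      ... | false | true  | just β with β F.≟ α
      ...   | yes refl = contradiction refl (proper x z α α (T-≡ .from adj) γx γz)
      ...   | no  _    = refl

    usedOn : List (Elt G) → Fin c → Bool
    usedOn ys β = any (λ y → S y ∧ isCol G (γ y) β) ys

    usedOn-∉ : InjectiveOnS → ∀ {y α ys} → All (y ≢_) ys → S y ≡ true → γ y ≡ just α →
               usedOn ys α ≡ false
    usedOn-∉ inj {y} {α} y∉ys Sy γy = any-≡false _ (All.map (λ {z} → notColoured z) y∉ys)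
      where
      notColoured : ∀ z → y ≢ z → S z ∧ isCol G (γ z) α ≡ false
      notColoured z y≢z with S z in Sz | γ z in γz
      ... | false | _       = refl
      ... | true  | nothing = refl
      ... | true  | just β with β F.≟ α
      ...   | yes refl = contradiction (inj Sy Sz γy γz) y≢z
      ...   | no  _    = refl

    count-usedOn : InjectiveOnS → ∀ (h : Subset c) ys → Unique ys →
      count (λ β → Vec.lookup h β ∧ usedOn ys β) (allFin c) ≡ count (λ y → S y ∧ colIn (γ y) h) ys
    count-usedOn inj h [] _ = count-none (λ β → ∧-zeroʳ (Vec.lookup h β)) (allFin c)
    count-usedOn inj h (y ∷ ys) (y∉ys ∷ ys-unique) with S y in Sy | γ y in γy
    ... | false | _       = count-usedOn inj h ys ys-unique
    ... | true  | nothing = count-usedOn inj h ys ys-unique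
    ... | true  | just α with Vec.lookup h α in hα
    ...   | true  = begin
      count (λ β → h′ β ∧ (⌊ α F.≟ β ⌋ ∨ u β)) (allFin c)
        ≡⟨ count-∈ F._≟_ _ (Unique.allFin⁺ c) (∈-allFin α) αCounted ⟩
      suc (count (λ β → (h′ β ∧ (⌊ α F.≟ β ⌋ ∨ u β)) ∧ not ⌊ β F.≟ α ⌋) (allFin c))
        ≡⟨ cong suc (count-cong dropα (allFin c)) ⟩
      suc (count (λ β → h′ β ∧ u β) (allFin c))
        ≡⟨ cong suc (count-usedOn inj h ys ys-unique) ⟩
      suc (count (λ z → S z ∧ colIn (γ z) h) ys)
        ∎
      where
      open ≡-Reasoning
      h′ u : Fin c → Bool
      h′ = Vec.lookup h
      u  = usedOn ys
      uα : u α ≡ false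
      uα = usedOn-∉ inj y∉ys Sy γy
      αCounted : h′ α ∧ (⌊ α F.≟ α ⌋ ∨ u α) ≡ true
      αCounted with α F.≟ α
      ... | yes _   rewrite hα = refl
      ... | no  α≢α = contradiction refl α≢α
      dropα : ∀ β → (h′ β ∧ (⌊ α F.≟ β ⌋ ∨ u β)) ∧ not ⌊ β F.≟ α ⌋ ≡ h′ β ∧ u β
      dropα β with β F.≟ α
      ... | yes refl rewrite uα = trans (∧-zeroʳ _) (sym (∧-zeroʳ _))
      ... | no  β≢α with α F.≟ β
      ...   | yes refl = contradiction refl β≢α
      ...   | no  _    = ∧-identityʳ _
    ...   | false = trans (count-cong αUnavailable (allFin c)) (count-usedOn inj h ys ys-unique)
      where
      αUnavailable : ∀ β → Vec.lookup h β ∧ (⌊ α F.≟ β ⌋ ∨ usedOn ys β) ≡ Vec.lookup h β ∧ usedOn ys β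
      αUnavailable β with α F.≟ β
      ... | yes refl rewrite hα = refl
      ... | no  _    = refl

    hat⊆U : ∀ {x β} → S x ≡ true → Vec.lookup (hat x) β ≡ true → U β ≡ true
    hat⊆U {x} Sx hβ = any-≡true _ (∈-eltList x) (cong₂ _∧_ Sx hβ)

    countHV-split : ∀ p → countHV p ≡ count (p ∘ inj₁) (eltList G) + count (p ∘ inj₂) (allFin c)
    countHV-split p = trans (count-++ p (map inj₁ (eltList G)) (map inj₂ (allFin c)))
      (cong₂ _+_ (count-map p inj₁ (eltList G)) (count-map p inj₂ (allFin c)))

    inDeg-element : ∀ {x} → S x ≡ true →
      inDeg (inj₁ x) ≡ count (λ y → (S y ∧ colIn (γ y) (hat x)) ∧ not ⌊ y ≟ᴱ x ⌋) (eltList G)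
                     + count (λ β → Vec.lookup (hat x) β ∧ not (γS β)) (allFin c)
    inDeg-element {x} Sx =
      trans (countHV-split _)
            (cong₂ _+_ (count-cong arcFromS (eltList G)) (count-cong arcFromColour (allFin c)))
      where
      arcFromS : ∀ y → S y ∧ (S y ∧ (S x ∧ (not (eqElt G y x) ∧ colIn (γ y) (hat x))))
                    ≡ (S y ∧ colIn (γ y) (hat x)) ∧ not ⌊ y ≟ᴱ x ⌋
      arcFromS y rewrite Sx | eqElt≡⌊≟ᴱ⌋ y x with S y
      ... | true  = ∧-comm (not ⌊ y ≟ᴱ x ⌋) (colIn (γ y) (hat x))
      ... | false = refl
      arcFromColour : ∀ β → U β ∧ (U β ∧ (S x ∧ (Vec.lookup (hat x) β ∧ not (γS β))))
                         ≡ Vec.lookup (hat x) β ∧ not (γS β)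
      arcFromColour β rewrite Sx with Vec.lookup (hat x) β in hβ
      ... | false = trans (cong (U β ∧_) (∧-zeroʳ _)) (∧-zeroʳ _)
      ... | true  rewrite hat⊆U Sx hβ = refl

    inDeg-colour : ∀ {α} → U α ≡ true →
      inDeg (inj₂ α) ≡ count S (eltList G) + count (λ β → U β ∧ not ⌊ β F.≟ α ⌋) (allFin c)
    inDeg-colour {α} Uα =
      trans (countHV-split _)
            (cong₂ _+_ (count-cong arcFromS (eltList G)) (count-cong arcFromColour (allFin c)))
      where
      arcFromS : ∀ y → S y ∧ (S y ∧ U α) ≡ S y
      arcFromS y with S y
      ... | true  = Uα
      ... | false = refl
      arcFromColour : ∀ β → U β ∧ (U β ∧ (U α ∧ not ⌊ β F.≟ α ⌋)) ≡ U β ∧ not ⌊ β F.≟ α ⌋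
      arcFromColour β rewrite Uα with U β
      ... | true  = refl
      ... | false = refl

    suc-inDeg-element : IsPartialColoring G L γ → IsClique G S →
      ∀ {x α} → S x ≡ true → γ x ≡ just α → suc (inDeg (inj₁ x)) ≡ ∣ hat x ∣
    suc-inDeg-element pc clique {x} Sx γx = begin
      suc (inDeg (inj₁ x))
        ≡⟨ cong suc (inDeg-element Sx) ⟩
      suc (count (λ y → hatColoured y ∧ not ⌊ y ≟ᴱ x ⌋) (eltList G) + count unusedInHat (allFin c))
        ≡⟨ cong (_+ count unusedInHat (allFin c))
                (count-∈ _≟ᴱ_ hatColoured eltList-unique (∈-eltList x) xHatColoured) ⟨
      count hatColoured (eltList G) + count unusedInHat (allFin c)
        ≡⟨ cong (_+ count unusedInHat (allFin c))
                (count-usedOn (clique⇒injectiveOnS pc clique) (hat x) (eltList G) eltList-unique) ⟨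
      count (λ β → h β ∧ γS β) (allFin c) + count unusedInHat (allFin c)
        ≡⟨ count-partition h γS (allFin c) ⟨
      count h (allFin c)
        ≡⟨ ∣p∣≡count-allFin (hat x) ⟨
      ∣ hat x ∣
        ∎
      where
      open ≡-Reasoning
      h : Fin c → Bool
      h = Vec.lookup (hat x)
      hatColoured : Elt G → Bool
      hatColoured y = S y ∧ colIn (γ y) (hat x)
      unusedInHat : Fin c → Bool
      unusedInHat β = h β ∧ not (γS β)
      xHatColoured : hatColoured x ≡ true
      xHatColoured rewrite Sx | γx = γ∈hat pc γx

    suc-inDeg-colour : ∀ {α} → U α ≡ true → suc (inDeg (inj₂ α)) ≡ sizeH
    suc-inDeg-colour {α} Uα = begin
      suc (inDeg (inj₂ α))
        ≡⟨ cong suc (inDeg-colour Uα) ⟩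
      suc (count S (eltList G) + count (λ β → U β ∧ not ⌊ β F.≟ α ⌋) (allFin c))
        ≡⟨ +-suc _ _ ⟨
      count S (eltList G) + suc (count (λ β → U β ∧ not ⌊ β F.≟ α ⌋) (allFin c))
        ≡⟨ cong (count S (eltList G) +_) (count-∈ F._≟_ U (Unique.allFin⁺ c) (∈-allFin α) Uα) ⟨
      count S (eltList G) + count U (allFin c)
        ≡⟨ countHV-split inH ⟨
      sizeH
        ∎
      where open ≡-Reasoning

lemma3 : (G : Graph) (c : ℕ) (L : Elt G → Subset c) (γ : Elt G → Maybe (Fin c))
         (S : Elt G → Bool) →
         IsPartialColoring G L γ → IsClique G S → AllColored G γ S →
         ((x : Elt G) → T (S x) →
           suc (ColorShift.inDeg G L γ S (inj₁ x)) ≡ ∣ ColorShift.hat G L γ S x ∣)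
         × ((α : Fin c) → T (ColorShift.U G L γ S α) →
           suc (ColorShift.inDeg G L γ S (inj₂ α)) ≡ ColorShift.sizeH G L γ S)
lemma3 G c L γ S pc clique coloured =
  (λ x Sx → suc-inDeg-element G L γ S pc clique (T-≡ .to Sx) (proj₂ (coloured x Sx))) ,
  (λ α Uα → suc-inDeg-colour G L γ S (T-≡ .to Uα))
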